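{- Let $G=C_N$ be the cycle graph on $N\geq 3$ nodes and let $t\in\{1,\ldots,N\}$. Then $\chi_t(G)=t$ if and only if $G$ is circularly $t$-partite.
   Context: All graphs are finite, simple and connected. A path of length $t$ is a sequence $v_1,\ldots,v_{t+1}$ of distinct vertices with $v_j\sim v_{j+1}$; its endpoints are $v_1$ and $v_{t+1}$. A (not necessarily proper) colouring of the vertices is $t$-periodic if every path of length $t$ has endpoints of the same colour; $\chi_t(G)$ is the largest $k$ such that $G$ has a $t$-periodic colouring of the vertices using exactly $k$ colours. An oriented edge $[v,w]$ is an edge $\{v,w\}$ with input $v$ and output $w$; $\mathcal{O}=\{[v,w],[w,v]: v\sim w\}$. For $k\geq 1$, $G$ is circularly $k$-partite if $\mathcal{O}$ can be partitioned as $\mathcal{O}=\mathcal{O}_1\sqcup\cdots\sqcup\mathcal{O}_k$ with all $\mathcal{O}_j$ non-empty and such that $[v,w]\in\mathcal{O}_j$ implies $[w,z]\in\mathcal{O}_{j+1}$ for every $z\sim w$ with $z\neq v$, indices modulo $k$. -}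

module Defs where

open import Data.Nat using (ℕ; zero; suc; _≤_; _<_)
open import Data.Nat.DivMod using (_%_; m%n<n)
open import Data.Fin using (Fin; zero; suc; toℕ; fromℕ; fromℕ<; inject₁)
open import Data.Product using (Σ; ∃; _×_; _,_)
open import Data.Sum using (_⊎_)
open import Relation.Binary.PropositionalEquality using (_≡_; _≢_)
open import Function.Definitions using (Injective)

record Path {n : ℕ} (_~_ : Fin n → Fin n → Set) (t : ℕ) : Set where
  field
    vtx      : Fin (suc t) → Fin n
    distinct : Injective _≡_ _≡_ vtx
    adjacent : (i : Fin t) → vtx (inject₁ i) ~ vtx (suc i)

open Path public

-- A colouring with exactly k colours: a surjection onto Fin k.
Surjective : {A : Set} {k : ℕ} → (A → Fin k) → Set
Surjective {A} {k} c = (j : Fin k) → ∃ λ (v : A) → c v ≡ j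

Periodic : {n : ℕ} (_~_ : Fin n → Fin n → Set) (t : ℕ) {k : ℕ} → (Fin n → Fin k) → Set
Periodic _~_ t c = (p : Path _~_ t) → c (vtx p zero) ≡ c (vtx p (fromℕ t))

HasPeriodicColouring : {n : ℕ} (_~_ : Fin n → Fin n → Set) (t k : ℕ) → Set
HasPeriodicColouring {n} _~_ t k =
  Σ (Fin n → Fin k) λ c → Surjective c × Periodic _~_ t c

-- χ_t(G) = k : k is the largest number of colours of a t-periodic colouring.
ChiIs : {n : ℕ} (_~_ : Fin n → Fin n → Set) (t k : ℕ) → Set
ChiIs _~_ t k =
  HasPeriodicColouring _~_ t k × ((m : ℕ) → HasPeriodicColouring _~_ t m → m ≤ k)

sucMod : {k : ℕ} → Fin k → Fin k
sucMod {suc k} i = fromℕ< (m%n<n (suc (toℕ i)) (suc k))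

-- Circularly k-partite: a partition O = O_1 ⊔ … ⊔ O_k of the oriented edges
-- (given as the class-assignment function f), all classes non-empty, such that
-- [v,w] ∈ O_j implies [w,z] ∈ O_{j+1} for all z ~ w with z ≠ v (indices mod k).
CircularlyPartite : {n : ℕ} (_~_ : Fin n → Fin n → Set) (k : ℕ) → Set
CircularlyPartite {n} _~_ k =
  Σ ((v w : Fin n) → v ~ w → Fin k) λ f →
    ((j : Fin k) → ∃ λ v → ∃ λ w → Σ (v ~ w) λ e → f v w e ≡ j)
    × ((v w z : Fin n) (e : v ~ w) (e' : w ~ z) → z ≢ v → f w z e' ≡ sucMod (f v w e))

CycleAdj : (N : ℕ) → Fin N → Fin N → Set
CycleAdj N v w =
  (suc (toℕ v) ≡ toℕ w) ⊎ (suc (toℕ w) ≡ toℕ v)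
  ⊎ ((suc (toℕ v) ≡ N) × (toℕ w ≡ 0)) ⊎ ((suc (toℕ w) ≡ N) × (toℕ v ≡ 0))

-- Both conditions are equivalent to t ∣ N.  If t ∣ N, the residue v mod t is a t-periodic
-- colouring with t colours (a path of length t never turns back, so it moves t steps in one
-- direction), and classing a clockwise edge out of v by v mod t and an anticlockwise one by
-- (N − v) mod t is a circular t-partition.  Conversely, shifting along clockwise paths shows
-- that a t-periodic colouring only depends on the residue of the vertex mod t, and if t ∤ N
-- the residues 0 and N mod t get the same colour, so fewer than t colours occur; and the
-- classes of a circular t-partition increase by one around the cycle, forcing t ∣ N.
module Submission where

open import Defs
open import Data.Empty using (⊥-elim)
open import Data.Fin using (Fin; zero; suc; toℕ; fromℕ; fromℕ<; inject₁; punchOut; _≟_)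
open import Data.Fin.Properties
  using (toℕ-injective; toℕ-fromℕ<; toℕ<n; fromℕ<-cong; toℕ-inject₁; toℕ-fromℕ; injective⇒≤; punchOut-injective)
open import Data.Nat using (ℕ; zero; suc; _+_; _*_; _∸_; _≤_; _<_; s≤s; NonZero; >-nonZero⁻¹)
open import Data.Nat.DivMod
open import Data.Nat.Divisibility using (_∣_; divides; _∣?_; ∣m+n∣m⇒∣n; n∣m*n; ∣⇒≤; n∣m⇒m%n≡0; ∣-refl)
open import Data.Nat.Properties hiding (_≟_)
open import Data.Product using (Σ; ∃; _×_; _,_; proj₁; proj₂)
open import Data.Sum using (_⊎_; inj₁; inj₂)
open import Function.Base using (_∘_)
open import Function.Bundles using (_⇔_; mk⇔)
open import Relation.Binary.PropositionalEquality
open import Relation.Nullary using (yes; no)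

open ≡-Reasoning

[m+n%o]%o≡[m+n]%o : ∀ m n o .{{_ : NonZero o}} → (m + n % o) % o ≡ (m + n) % o
[m+n%o]%o≡[m+n]%o m n o = begin
  (m + n % o) % o             ≡⟨ %-distribˡ-+ m (n % o) o ⟩
  (m % o + n % o % o) % o     ≡⟨ cong (λ x → (m % o + x) % o) (m%n%n≡m%n n o) ⟩
  (m % o + n % o) % o         ≡⟨ %-distribˡ-+ m n o ⟨
  (m + n) % o                 ∎

[m+n]%o≡n%o⇒o∣m : ∀ m n o .{{_ : NonZero o}} → (m + n) % o ≡ n % o → o ∣ m
[m+n]%o≡n%o⇒o∣m m n o eq = ∣m+n∣m⇒∣n (divides ((m + n) / o) shifted) (n∣m*n (n / o))
  where
  shifted : n / o * o + m ≡ (m + n) / o * o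
  shifted = +-cancelˡ-≡ (n % o) _ _ (begin
    n % o + (n / o * o + m)        ≡⟨ +-assoc (n % o) _ m ⟨
    n % o + n / o * o + m          ≡⟨ cong (_+ m) (m≡m%n+[m/n]*n n o) ⟨
    n + m                          ≡⟨ +-comm n m ⟩
    m + n                          ≡⟨ m≡m%n+[m/n]*n (m + n) o ⟩
    (m + n) % o + (m + n) / o * o  ≡⟨ cong (_+ (m + n) / o * o) eq ⟩
    n % o + (m + n) / o * o        ∎)

∣∧<⇒≡0 : ∀ {m n} → m ∣ n → n < m → n ≡ 0
∣∧<⇒≡0 {n = zero}  _   _   = refl
∣∧<⇒≡0 {n = suc _} m∣n n<m = ⊥-elim (<⇒≱ n<m (∣⇒≤ m∣n))

module _ {o : ℕ} .{{_ : NonZero o}} where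

  toℕ-mod : ∀ m → toℕ (m mod o) ≡ m % o
  toℕ-mod m = toℕ-fromℕ< (m%n<n m o)

  mod-cong : ∀ {m n} → m % o ≡ n % o → m mod o ≡ n mod o
  mod-cong eq = fromℕ<-cong _ _ eq _ _

  mod-toℕ : (i : Fin o) → toℕ i mod o ≡ i
  mod-toℕ i = toℕ-injective (trans (toℕ-mod (toℕ i)) (m<n⇒m%n≡m (toℕ<n i)))

  [o+i]mod-o≡i : (i : Fin o) → (o + toℕ i) mod o ≡ i
  [o+i]mod-o≡i i = trans (mod-cong (%-remove-+ˡ (toℕ i) ∣-refl)) (mod-toℕ i)

  [m+n]mod-o≡n-mod-o⇒o∣m : ∀ m n → (m + n) mod o ≡ n mod o → o ∣ m
  [m+n]mod-o≡n-mod-o⇒o∣m m n eq =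
    [m+n]%o≡n%o⇒o∣m m n o (trans (sym (toℕ-mod (m + n))) (trans (cong toℕ eq) (toℕ-mod n)))

  +-mod-injective-≤ : ∀ a {i j} → i ≤ j → j < o → (a + i) mod o ≡ (a + j) mod o → i ≡ j
  +-mod-injective-≤ a {i} {j} i≤j j<o eq = ≤-antisym i≤j (m∸n≡0⇒m≤n j∸i≡0)
    where
    rearrange : j ∸ i + (a + i) ≡ a + j
    rearrange = begin
      j ∸ i + (a + i)  ≡⟨ cong (j ∸ i +_) (+-comm a i) ⟩
      j ∸ i + (i + a)  ≡⟨ +-assoc (j ∸ i) i a ⟨
      j ∸ i + i + a    ≡⟨ cong (_+ a) (m∸n+n≡m i≤j) ⟩
      j + a            ≡⟨ +-comm j a ⟩
      a + j            ∎
    j∸i≡0 : j ∸ i ≡ 0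
    j∸i≡0 = ∣∧<⇒≡0 ([m+n]mod-o≡n-mod-o⇒o∣m (j ∸ i) (a + i) (trans (cong (_mod o) rearrange) (sym eq)))
                   (≤-<-trans (m∸n≤m j i) j<o)

  +-mod-injectiveʳ : ∀ a {i j} → i < o → j < o → (a + i) mod o ≡ (a + j) mod o → i ≡ j
  +-mod-injectiveʳ a {i} {j} i<o j<o eq with ≤-total i j
  ... | inj₁ i≤j = +-mod-injective-≤ a i≤j j<o eq
  ... | inj₂ j≤i = sym (+-mod-injective-≤ a j≤i i<o (sym eq))

toℕ-sucMod : ∀ {n} .{{_ : NonZero n}} (i : Fin n) → toℕ (sucMod i) ≡ suc (toℕ i) % n
toℕ-sucMod {suc n} i = toℕ-mod (suc (toℕ i))

sucMod-mod : ∀ {n} .{{_ : NonZero n}} m → sucMod (m mod n) ≡ suc m mod n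
sucMod-mod {n} m = toℕ-injective (begin
  toℕ (sucMod (m mod n))     ≡⟨ toℕ-sucMod (m mod n) ⟩
  suc (toℕ (m mod n)) % n    ≡⟨ cong (λ x → suc x % n) (toℕ-mod m) ⟩
  suc (m % n) % n            ≡⟨ [m+n%o]%o≡[m+n]%o 1 m n ⟩
  suc m % n                  ≡⟨ toℕ-mod (suc m) ⟨
  toℕ (suc m mod n)          ∎)

module _ {t : ℕ} .{{_ : NonZero t}} (r : ℕ → Fin t) where

  iterate-sucMod : ∀ k → (∀ i → i < k → r (suc i) ≡ sucMod (r i)) → r k ≡ (k + toℕ (r 0)) mod t
  iterate-sucMod zero    _    = sym (mod-toℕ (r 0))
  iterate-sucMod (suc k) next = begin
    r (suc k)                          ≡⟨ next k ≤-refl ⟩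
    sucMod (r k)                       ≡⟨ cong sucMod (iterate-sucMod k (λ i i<k → next i (m<n⇒m<1+n i<k))) ⟩
    sucMod ((k + toℕ (r 0)) mod t)     ≡⟨ sucMod-mod (k + toℕ (r 0)) ⟩
    (suc k + toℕ (r 0)) mod t          ∎

  iterate-sucMod-backward : ∀ k → (∀ i → i < k → r i ≡ sucMod (r (suc i))) → r 0 ≡ (k + toℕ (r k)) mod t
  iterate-sucMod-backward zero    _    = sym (mod-toℕ (r 0))
  iterate-sucMod-backward (suc k) prev = begin
    r 0                                       ≡⟨ iterate-sucMod-backward k (λ i i<k → prev i (m<n⇒m<1+n i<k)) ⟩
    (k + toℕ (r k)) mod t                     ≡⟨ cong (λ x → (k + toℕ x) mod t) (prev k ≤-refl) ⟩
    (k + toℕ (sucMod (r (suc k)))) mod t      ≡⟨ mod-cong (begin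
      (k + toℕ (sucMod (r (suc k)))) % t          ≡⟨ cong (λ x → (k + x) % t) (toℕ-sucMod (r (suc k))) ⟩
      (k + suc (toℕ (r (suc k))) % t) % t         ≡⟨ [m+n%o]%o≡[m+n]%o k _ t ⟩
      (k + suc (toℕ (r (suc k)))) % t             ≡⟨ cong (_% t) (+-suc k _) ⟩
      (suc k + toℕ (r (suc k))) % t               ∎) ⟩
    (suc k + toℕ (r (suc k))) mod t           ∎

surjective⇒≤ : ∀ {n m} (g : Fin n → Fin m) → Surjective g → m ≤ n
surjective⇒≤ g onto = injective⇒≤ {f = λ y → proj₁ (onto y)} λ {y} {y′} eq →
  trans (sym (proj₂ (onto y))) (trans (cong g eq) (proj₂ (onto y′)))

surjective-collision⇒< : ∀ {n m} (g : Fin n → Fin m) → Surjective g →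
                         ∀ {i j} → i ≢ j → g i ≡ g j → m < n
surjective-collision⇒< {suc n} {m} g onto {i} {j} i≢j gi≡gj =
  s≤s (injective⇒≤ {f = λ y → punchOut (avoids-i y)} λ {y} {y′} eq →
    trans (sym (hits y)) (trans (cong g (punchOut-injective (avoids-i y) (avoids-i y′) eq)) (hits y′)))
  where
  preimage : (y : Fin m) → Σ (Fin (suc n)) λ x → i ≢ x × g x ≡ y
  preimage y with onto y
  ... | x , gx≡y with i ≟ x
  ...   | yes refl = j , i≢j , trans (sym gi≡gj) gx≡y
  ...   | no i≢x   = x , i≢x , gx≡y
  avoids-i : (y : Fin m) → i ≢ proj₁ (preimage y)
  avoids-i y = proj₁ (proj₂ (preimage y))
  hits : (y : Fin m) → g (proj₁ (preimage y)) ≡ y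
  hits y = proj₂ (proj₂ (preimage y))

Clockwise : ∀ {N} → Fin N → Fin N → Set
Clockwise {N} v w = (suc (toℕ v) ≡ toℕ w) ⊎ (suc (toℕ v) ≡ N × toℕ w ≡ 0)

module _ {N : ℕ} where

  orient : {v w : Fin N} → CycleAdj N v w → Clockwise v w ⊎ Clockwise w v
  orient (inj₁ v→w)               = inj₁ (inj₁ v→w)
  orient (inj₂ (inj₁ w→v))        = inj₂ (inj₁ w→v)
  orient (inj₂ (inj₂ (inj₁ v→w))) = inj₁ (inj₂ v→w)
  orient (inj₂ (inj₂ (inj₂ w→v))) = inj₂ (inj₂ w→v)

  clockwise⇒adj : {v w : Fin N} → Clockwise v w → CycleAdj N v w
  clockwise⇒adj (inj₁ v→w) = inj₁ v→w
  clockwise⇒adj (inj₂ v→w) = inj₂ (inj₂ (inj₁ v→w))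

  orient∘clockwise⇒adj : {v w : Fin N} (s : Clockwise v w) → orient (clockwise⇒adj s) ≡ inj₁ s
  orient∘clockwise⇒adj (inj₁ _) = refl
  orient∘clockwise⇒adj (inj₂ _) = refl

  Clockwise-injective : {u v w : Fin N} → Clockwise u w → Clockwise v w → u ≡ v
  Clockwise-injective (inj₁ p)       (inj₁ q)       = toℕ-injective (suc-injective (trans p (sym q)))
  Clockwise-injective (inj₁ p)       (inj₂ (_ , q)) = ⊥-elim (1+n≢0 (trans p q))
  Clockwise-injective (inj₂ (_ , p)) (inj₁ q)       = ⊥-elim (1+n≢0 (trans q p))
  Clockwise-injective (inj₂ (p , _)) (inj₂ (q , _)) = toℕ-injective (suc-injective (trans p (sym q)))

  Clockwise-functional : {u v w : Fin N} → Clockwise u v → Clockwise u w → v ≡ w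
  Clockwise-functional (inj₁ p)       (inj₁ q)       = toℕ-injective (trans (sym p) q)
  Clockwise-functional {v = v} (inj₁ p) (inj₂ (q , _)) = ⊥-elim (<-irrefl (trans (sym p) q) (toℕ<n v))
  Clockwise-functional {w = w} (inj₂ (p , _)) (inj₁ q) = ⊥-elim (<-irrefl (trans (sym q) p) (toℕ<n w))
  Clockwise-functional (inj₂ (_ , p)) (inj₂ (_ , q)) = toℕ-injective (trans p (sym q))

Clockwise-sucMod : ∀ {N} (v : Fin N) → Clockwise v (sucMod v)
Clockwise-sucMod {suc N} v with m≤n⇒m<n∨m≡n (toℕ<n v)
... | inj₁ 1+v<N = inj₁ (sym (trans (toℕ-sucMod v) (m<n⇒m%n≡m 1+v<N)))
... | inj₂ 1+v≡N = inj₂ (1+v≡N , trans (toℕ-sucMod v) (trans (cong (_% suc N) 1+v≡N) (n%n≡0 (suc N))))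

sucMod∘sucMod≢id : ∀ {N} .{{_ : NonZero N}} → 3 ≤ N → (v : Fin N) → sucMod (sucMod v) ≢ v
sucMod∘sucMod≢id {N} 3≤N v eq = <⇒≱ 3≤N (∣⇒≤ ([m+n]mod-o≡n-mod-o⇒o∣m 2 (toℕ v) (begin
  (2 + toℕ v) mod N              ≡⟨ sucMod-mod (suc (toℕ v)) ⟨
  sucMod (suc (toℕ v) mod N)     ≡⟨ cong sucMod (sucMod-mod (toℕ v)) ⟨
  sucMod (sucMod (toℕ v mod N))  ≡⟨ cong (sucMod ∘ sucMod) (mod-toℕ v) ⟩
  sucMod (sucMod v)              ≡⟨ eq ⟩
  v                              ≡⟨ mod-toℕ v ⟨
  toℕ v mod N                    ∎)))

module _ {N : ℕ} {u v w : Fin N} where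

  clockwise-persists : Clockwise u v → CycleAdj N v w → w ≢ u → Clockwise v w
  clockwise-persists u→v v~w w≢u with orient v~w
  ... | inj₁ v→w = v→w
  ... | inj₂ w→v = ⊥-elim (w≢u (Clockwise-injective w→v u→v))

  anticlockwise-persists : Clockwise v u → CycleAdj N v w → w ≢ u → Clockwise w v
  anticlockwise-persists v→u v~w w≢u with orient v~w
  ... | inj₁ v→w = ⊥-elim (w≢u (Clockwise-functional v→w v→u))
  ... | inj₂ w→v = w→v

module _ {N t : ℕ} .{{_ : NonZero t}} (t∣N : t ∣ N) {v w : Fin N} where

  clockwise⇒sucMod : Clockwise v w → toℕ w mod t ≡ sucMod (toℕ v mod t)
  clockwise⇒sucMod v→w = trans (mod-cong (residues v→w)) (sym (sucMod-mod (toℕ v)))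
    where
    residues : Clockwise v w → toℕ w % t ≡ suc (toℕ v) % t
    residues (inj₁ 1+v≡w) = cong (_% t) (sym 1+v≡w)
    residues (inj₂ (1+v≡N , w≡0)) = begin
      toℕ w % t         ≡⟨ cong (_% t) w≡0 ⟩
      0 % t             ≡⟨ m*n%n≡0 0 t ⟩
      0                 ≡⟨ n∣m⇒m%n≡0 N t t∣N ⟨
      N % t             ≡⟨ cong (_% t) 1+v≡N ⟨
      suc (toℕ v) % t   ∎

  clockwise⇒sucMod-reflected : Clockwise w v → (N ∸ toℕ w) mod t ≡ sucMod ((N ∸ toℕ v) mod t)
  clockwise⇒sucMod-reflected w→v = trans (mod-cong (residues w→v)) (sym (sucMod-mod (N ∸ toℕ v)))
    where
    residues : Clockwise w v → (N ∸ toℕ w) % t ≡ suc (N ∸ toℕ v) % t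
    residues (inj₁ 1+w≡v) = cong (_% t) (begin
      N ∸ toℕ w              ≡⟨ +-∸-assoc 1 (<⇒≤ (subst (_< N) (sym 1+w≡v) (toℕ<n v))) ⟩
      suc (N ∸ suc (toℕ w))  ≡⟨ cong (λ x → suc (N ∸ x)) 1+w≡v ⟩
      suc (N ∸ toℕ v)        ∎)
    residues (inj₂ (1+w≡N , v≡0)) = begin
      (N ∸ toℕ w) % t        ≡⟨ cong (λ x → (x ∸ toℕ w) % t) 1+w≡N ⟨
      (1 + toℕ w ∸ toℕ w) % t ≡⟨ cong (_% t) (m+n∸n≡m 1 (toℕ w)) ⟩
      1 % t                  ≡⟨ %-remove-+ʳ 1 t∣N ⟨
      suc N % t              ≡⟨ cong (λ x → suc (N ∸ x) % t) v≡0 ⟨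
      suc (N ∸ toℕ v) % t    ∎

-- A walk of length k in C_N, indexed by ℕ; only the positions 0 … k carry information.
record NonBacktrackingWalk (N k : ℕ) : Set where
  field
    at                 : ℕ → Fin N
    at-adjacent        : ∀ i → i < k → CycleAdj N (at i) (at (suc i))
    at-nonbacktracking : ∀ i → suc i < k → at (suc (suc i)) ≢ at i

module _ {N k : ℕ} (W : NonBacktrackingWalk N k) where
  open NonBacktrackingWalk W

  walk-clockwise : Clockwise (at 0) (at 1) → ∀ i → i < k → Clockwise (at i) (at (suc i))
  walk-clockwise s₀ zero    _     = s₀
  walk-clockwise s₀ (suc i) 1+i<k =
    clockwise-persists (walk-clockwise s₀ i (<-trans (n<1+n i) 1+i<k)) (at-adjacent (suc i) 1+i<k) (at-nonbacktracking i 1+i<k)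

  walk-anticlockwise : Clockwise (at 1) (at 0) → ∀ i → i < k → Clockwise (at (suc i)) (at i)
  walk-anticlockwise s₀ zero    _     = s₀
  walk-anticlockwise s₀ (suc i) 1+i<k =
    anticlockwise-persists (walk-anticlockwise s₀ i (<-trans (n<1+n i) 1+i<k)) (at-adjacent (suc i) 1+i<k) (at-nonbacktracking i 1+i<k)

module _ {N t : ℕ} .{{_ : NonZero t}} (t∣N : t ∣ N) (W : NonBacktrackingWalk N t) where
  open NonBacktrackingWalk W

  private
    residue : ℕ → Fin t
    residue i = toℕ (at i) mod t

  walk-ends-congruent : toℕ (at 0) mod t ≡ toℕ (at t) mod t
  walk-ends-congruent with orient (at-adjacent 0 (>-nonZero⁻¹ t))
  ... | inj₁ s₀ = sym (trans (iterate-sucMod residue t λ i i<t → clockwise⇒sucMod t∣N (walk-clockwise W s₀ i i<t))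
                            ([o+i]mod-o≡i (residue 0)))
  ... | inj₂ s₀ = trans (iterate-sucMod-backward residue t λ i i<t → clockwise⇒sucMod t∣N (walk-anticlockwise W s₀ i i<t))
                        ([o+i]mod-o≡i (residue t))

path⇒walk : ∀ {N k} → Path (CycleAdj N) k → NonBacktrackingWalk N k
path⇒walk {N} {k} p = record { at = at ; at-adjacent = at-adjacent ; at-nonbacktracking = at-nonbacktracking }
  where
  at : ℕ → Fin N
  at i = vtx p (i mod suc k)

  toℕ-index : ∀ {i} → i ≤ k → toℕ (i mod suc k) ≡ i
  toℕ-index {i} i≤k = trans (toℕ-mod i) (m≤n⇒m%n≡m i≤k)

  at-adjacent : ∀ i → i < k → CycleAdj N (at i) (at (suc i))
  at-adjacent i i<k = subst₂ (λ a b → CycleAdj N (vtx p a) (vtx p b)) source target (adjacent p (fromℕ< i<k))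
    where
    source : inject₁ (fromℕ< i<k) ≡ i mod suc k
    source = toℕ-injective (trans (toℕ-inject₁ _) (trans (toℕ-fromℕ< i<k) (sym (toℕ-index (<⇒≤ i<k)))))
    target : suc (fromℕ< i<k) ≡ suc i mod suc k
    target = toℕ-injective (trans (cong suc (toℕ-fromℕ< i<k)) (sym (toℕ-index i<k)))

  at-nonbacktracking : ∀ i → suc i < k → at (suc (suc i)) ≢ at i
  at-nonbacktracking i 2+i≤k eq = m≢1+n+m i (begin
    i                              ≡⟨ toℕ-index (m+n≤o⇒n≤o 2 2+i≤k) ⟨
    toℕ (i mod suc k)              ≡⟨ cong toℕ (distinct p eq) ⟨
    toℕ (suc (suc i) mod suc k)    ≡⟨ toℕ-index 2+i≤k ⟩
    suc (suc i)                    ∎)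

module _ {N t : ℕ} .{{_ : NonZero N}} .{{_ : NonZero t}} where

  residueColouring : Fin N → Fin t
  residueColouring v = toℕ v mod t

  residueColouring-section : t ≤ N → (j : Fin t) → residueColouring (toℕ j mod N) ≡ j
  residueColouring-section t≤N j = begin
    toℕ (toℕ j mod N) mod t  ≡⟨ cong (_mod t) (trans (toℕ-mod (toℕ j)) (m<n⇒m%n≡m (<-≤-trans (toℕ<n j) t≤N))) ⟩
    toℕ j mod t              ≡⟨ mod-toℕ j ⟩
    j                        ∎

  residueColouring-periodic : t ∣ N → Periodic (CycleAdj N) t residueColouring
  residueColouring-periodic t∣N p = begin
    toℕ (vtx p zero) mod t          ≡⟨ walk-ends-congruent t∣N (path⇒walk p) ⟩
    toℕ (vtx p (t mod suc t)) mod t ≡⟨ cong (λ i → toℕ (vtx p i) mod t) t-mod-1+t≡fromℕ ⟩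
    toℕ (vtx p (fromℕ t)) mod t     ∎
    where
    t-mod-1+t≡fromℕ : t mod suc t ≡ fromℕ t
    t-mod-1+t≡fromℕ = toℕ-injective (trans (toℕ-mod t) (trans (m≤n⇒m%n≡m ≤-refl) (sym (toℕ-fromℕ t))))

module _ {N t : ℕ} .{{_ : NonZero N}} .{{_ : NonZero t}} (t∣N : t ∣ N) where

  orientedClass : {v w : Fin N} → Clockwise v w ⊎ Clockwise w v → Fin t
  orientedClass {v} (inj₁ _) = toℕ v mod t
  orientedClass {v} (inj₂ _) = (N ∸ toℕ v) mod t

  orientedClass-next : {u v w : Fin N} (d : Clockwise u v ⊎ Clockwise v u) (d′ : Clockwise v w ⊎ Clockwise w v) →
                       w ≢ u → orientedClass d′ ≡ sucMod (orientedClass d)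
  orientedClass-next (inj₁ u→v) (inj₁ v→w) _   = clockwise⇒sucMod t∣N u→v
  orientedClass-next (inj₂ v→u) (inj₂ w→v) _   = clockwise⇒sucMod-reflected t∣N v→u
  orientedClass-next (inj₁ u→v) (inj₂ w→v) w≢u = ⊥-elim (w≢u (Clockwise-injective w→v u→v))
  orientedClass-next (inj₂ v→u) (inj₁ v→w) w≢u = ⊥-elim (w≢u (Clockwise-functional v→w v→u))

  ∣⇒circularlyPartite : t ≤ N → CircularlyPartite (CycleAdj N) t
  ∣⇒circularlyPartite t≤N = edgeClass , onto , λ _ _ _ e e′ → orientedClass-next (orient e) (orient e′)
    where
    edgeClass : (v w : Fin N) → CycleAdj N v w → Fin t
    edgeClass _ _ e = orientedClass (orient e)
    onto : (j : Fin t) → ∃ λ v → ∃ λ w → Σ (CycleAdj N v w) λ e → edgeClass v w e ≡ j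
    onto j = v , sucMod v , clockwise⇒adj (Clockwise-sucMod v) ,
      trans (cong orientedClass (orient∘clockwise⇒adj (Clockwise-sucMod v))) (residueColouring-section t≤N j)
      where
      v : Fin N
      v = toℕ j mod N

module _ {N t m : ℕ} .{{_ : NonZero N}} .{{_ : NonZero t}} (t≤N : t ≤ N)
         (c : Fin N → Fin m) (c-periodic : Periodic (CycleAdj N) t c) where

  clockwisePath : t < N → ℕ → Path (CycleAdj N) t
  clockwisePath t<N a = record { vtx = point ; distinct = point-injective ; adjacent = point-adjacent }
    where
    point : Fin (suc t) → Fin N
    point i = (a + toℕ i) mod N
    point-injective : ∀ {i j} → point i ≡ point j → i ≡ j
    point-injective {i} {j} = toℕ-injective ∘ +-mod-injectiveʳ a (<-≤-trans (toℕ<n i) t<N) (<-≤-trans (toℕ<n j) t<N)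
    point-adjacent : (i : Fin t) → CycleAdj N (point (inject₁ i)) (point (suc i))
    point-adjacent i rewrite toℕ-inject₁ i | +-suc a (toℕ i) | sym (sucMod-mod {N} (a + toℕ i)) =
      clockwise⇒adj (Clockwise-sucMod ((a + toℕ i) mod N))

  colour-+t : t < N → ∀ a → c (a mod N) ≡ c ((a + t) mod N)
  colour-+t t<N a = begin
    c (a mod N)                   ≡⟨ cong (λ x → c (x mod N)) (+-identityʳ a) ⟨
    c ((a + 0) mod N)             ≡⟨ c-periodic (clockwisePath t<N a) ⟩
    c ((a + toℕ (fromℕ t)) mod N) ≡⟨ cong (λ x → c ((a + x) mod N)) (toℕ-fromℕ t) ⟩
    c ((a + t) mod N)             ∎

  colour-+*t : t < N → ∀ a q → c ((a + q * t) mod N) ≡ c (a mod N)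
  colour-+*t t<N a zero    = cong (λ x → c (x mod N)) (+-identityʳ a)
  colour-+*t t<N a (suc q) = begin
    c ((a + (t + q * t)) mod N) ≡⟨ cong (λ x → c (x mod N)) (trans (cong (a +_) (+-comm t (q * t))) (sym (+-assoc a (q * t) t))) ⟩
    c ((a + q * t + t) mod N)   ≡⟨ colour-+t t<N (a + q * t) ⟨
    c ((a + q * t) mod N)       ≡⟨ colour-+*t t<N a q ⟩
    c (a mod N)                 ∎

  colour-% : ∀ x → c (x mod N) ≡ c ((x % t) mod N)
  colour-% x with m≤n⇒m<n∨m≡n t≤N
  ... | inj₁ t<N = trans (cong (λ y → c (y mod N)) (m≡m%n+[m/n]*n x t)) (colour-+*t t<N (x % t) (x / t))
  ... | inj₂ t≡N = cong c (mod-cong (sym (trans (cong (_% N) (%-congʳ t≡N)) (m%n%n≡m%n x N))))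

  colourOfResidue : Fin t → Fin m
  colourOfResidue i = c (toℕ i mod N)

  colourOfResidue-mod : ∀ x → colourOfResidue (x mod t) ≡ c (x mod N)
  colourOfResidue-mod x = trans (cong (λ y → c (y mod N)) (toℕ-mod x)) (sym (colour-% x))

  colourOfResidue-surjective : Surjective c → Surjective colourOfResidue
  colourOfResidue-surjective onto y with onto y
  ... | v , cv≡y = toℕ v mod t , trans (colourOfResidue-mod (toℕ v)) (trans (cong c (mod-toℕ v)) cv≡y)

module _ {N t : ℕ} .{{_ : NonZero N}} .{{_ : NonZero t}} (t≤N : t ≤ N) where

  periodic⇒≤ : ∀ {m} → HasPeriodicColouring (CycleAdj N) t m → m ≤ t
  periodic⇒≤ (c , onto , periodic) = surjective⇒≤ _ (colourOfResidue-surjective t≤N c periodic onto)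

  periodic⇒∣ : HasPeriodicColouring (CycleAdj N) t t → t ∣ N
  periodic⇒∣ (c , onto , periodic) with t ∣? N
  ... | yes t∣N = t∣N
  ... | no  t∤N = ⊥-elim (<-irrefl refl (surjective-collision⇒< g (colourOfResidue-surjective t≤N c periodic onto) 0≢N collide))
    where
    g : Fin t → Fin t
    g = colourOfResidue t≤N c periodic
    0≢N : 0 mod t ≢ N mod t
    0≢N eq = t∤N ([m+n]mod-o≡n-mod-o⇒o∣m N 0 (trans (cong (_mod t) (+-identityʳ N)) (sym eq)))
    collide : g (0 mod t) ≡ g (N mod t)
    collide = begin
      g (0 mod t)  ≡⟨ colourOfResidue-mod t≤N c periodic 0 ⟩
      c (0 mod N)  ≡⟨ cong c (mod-cong ([m+n]%n≡m%n 0 N)) ⟨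
      c (N mod N)  ≡⟨ colourOfResidue-mod t≤N c periodic N ⟨
      g (N mod t)  ∎

  ∣⇒χ≡t : t ∣ N → ChiIs (CycleAdj N) t t
  ∣⇒χ≡t t∣N = (residueColouring , onto , residueColouring-periodic t∣N) , λ _ → periodic⇒≤
    where
    onto : Surjective (residueColouring {N} {t})
    onto j = toℕ j mod N , residueColouring-section t≤N j

circularlyPartite⇒∣ : ∀ {N t} .{{_ : NonZero N}} .{{_ : NonZero t}} → 3 ≤ N →
                      CircularlyPartite (CycleAdj N) t → t ∣ N
circularlyPartite⇒∣ {N} {t} 3≤N (f , _ , f-next) = [m+n]mod-o≡n-mod-o⇒o∣m N (toℕ (r 0)) (begin
  (N + toℕ (r 0)) mod t  ≡⟨ iterate-sucMod r N (λ i _ → r-suc i) ⟨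
  r N                    ≡⟨ cong clockwiseClass (mod-cong ([m+n]%n≡m%n 0 N)) ⟩
  r 0                    ≡⟨ mod-toℕ (r 0) ⟨
  toℕ (r 0) mod t        ∎)
  where
  clockwiseClass : Fin N → Fin t
  clockwiseClass v = f v (sucMod v) (clockwise⇒adj (Clockwise-sucMod v))
  r : ℕ → Fin t
  r x = clockwiseClass (x mod N)
  r-suc : ∀ x → r (suc x) ≡ sucMod (r x)
  r-suc x = begin
    clockwiseClass (suc x mod N)             ≡⟨ cong clockwiseClass (sucMod-mod x) ⟨
    clockwiseClass (sucMod (x mod N))        ≡⟨ f-next _ _ _ _ _ (sucMod∘sucMod≢id 3≤N (x mod N)) ⟩
    sucMod (clockwiseClass (x mod N))        ∎

proposition5p1 : (N : ℕ) → 3 ≤ N → (t : ℕ) → 1 ≤ t → t ≤ N →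
                 ChiIs (CycleAdj N) t t ⇔ CircularlyPartite (CycleAdj N) t
proposition5p1 N@(suc _) 3≤N t@(suc _) _ t≤N = mk⇔
  (λ χ≡t     → ∣⇒circularlyPartite (periodic⇒∣ t≤N (proj₁ χ≡t)) t≤N)
  (λ partite → ∣⇒χ≡t t≤N (circularlyPartite⇒∣ 3≤N partite))
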